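{- For every $n\ge0$, the number of Dyck paths of semilength $n+1$ equals the number of symmetric Dyck paths in which the number of arches plus the number of half-arches is $n$.
   Context: A symmetric Dyck path (symmetric non-crossing perfect matching) is a word in $\{u,d\}$ in which every prefix has at least as many $u$'s as $d$'s. Each $d$ is matched to an earlier $u$ by parenthesis matching, forming an arch; the unmatched $u$'s are half-arches. A Dyck path of semilength $m$ is a word with $m$ letters $u$ and $m$ letters $d$ in which every prefix has at least as many $u$'s as $d$'s. -}

module Defs where

open import Data.Nat using (ℕ; zero; suc; _+_)
open import Data.Bool using (Bool; true; false; T)
open import Data.List using (List; []; _∷_)
open import Data.Product using (Σ; _×_; _,_; proj₁; proj₂)
open import Relation.Binary.PropositionalEquality using (_≡_)

data Step : Set where
  u d : Step

Word : Set
Word = List Step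

-- prefixOK h w : reading w starting from height h (= #u − #d so far),
-- every prefix keeps #u ≥ #d.
prefixOK : ℕ → Word → Bool
prefixOK h       []      = true
prefixOK h       (u ∷ w) = prefixOK (suc h) w
prefixOK zero    (d ∷ w) = false
prefixOK (suc h) (d ∷ w) = prefixOK h w

IsSymDyck : Word → Set
IsSymDyck w = T (prefixOK 0 w)

#u : Word → ℕ
#u []      = 0
#u (u ∷ w) = suc (#u w)
#u (d ∷ w) = #u w

#d : Word → ℕ
#d []      = 0
#d (u ∷ w) = #d w
#d (d ∷ w) = suc (#d w)

IsDyck : ℕ → Word → Set
IsDyck m w = (#u w ≡ m × #d w ≡ m) × IsSymDyck w

-- Parenthesis matching, scanning left to right with a stack of currently
-- unmatched u's (only its size matters).  match open arches w returns
-- (number of unmatched u's at the end , number of arches formed).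
-- A d with empty stack cannot occur in a symmetric Dyck path; it is ignored.
match : ℕ → ℕ → Word → ℕ × ℕ
match o a []            = o , a
match o a (u ∷ w)       = match (suc o) a w
match zero a (d ∷ w)    = match zero a w
match (suc o) a (d ∷ w) = match o (suc a) w

arches : Word → ℕ
arches w = proj₂ (match 0 0 w)

halfArches : Word → ℕ
halfArches w = proj₁ (match 0 0 w)

DyckPaths : ℕ → Set
DyckPaths m = Σ Word (IsDyck m)

SymDyckAH : ℕ → Set
SymDyckAH n = Σ Word (λ w → IsSymDyck w × arches w + halfArches w ≡ n)

{-# OPTIONS --safe #-}
module Submission where

-- A symmetric Dyck path factors uniquely as P₁ u P₂ u ⋯ u Pₖ with Dyck paths
-- Pᵢ, the displayed u's being its half-arches.  Sending it to the Dyck path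
-- u P₁ d u P₂ d ⋯ u Pₖ d is a bijection onto Dyck paths of one more semilength
-- that preserves the number of up-steps, and in a symmetric Dyck path every
-- up-step opens either an arch or a half-arch.

open import Defs
open import Data.Nat using (ℕ; zero; suc; _+_; _≤_; z≤n; s≤s)
open import Data.Nat.Properties
  using (+-suc; +-comm; +-identityʳ; n≤0⇒n≡0; ≡-irrelevant; suc-injective)
open import Data.Bool using (T)
open import Data.Bool.Properties using (T-irrelevant)
open import Data.List using ([]; _∷_)
open import Data.Product using (_×_; _,_; proj₁; proj₂)
open import Function.Bundles using (_⤖_; mk↔ₛ′)
open import Function.Properties.Inverse using (↔⇒⤖)
open import Relation.Nullary using (Irrelevant)
open import Relation.Binary.PropositionalEquality
  using (_≡_; refl; sym; trans; cong; cong₂; subst)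

Σ-≡-irrelevant : {A : Set} {P : A → Set} → (∀ a → Irrelevant (P a)) →
                 {a b : A} {p : P a} {q : P b} → a ≡ b → (a , p) ≡ (b , q)
Σ-≡-irrelevant irr {a} {p = p} {q} refl = cong (a ,_) (irr a p q)

×-irrelevant : {A B : Set} → Irrelevant A → Irrelevant B → Irrelevant (A × B)
×-irrelevant irrA irrB (a , b) (a′ , b′) = cong₂ _,_ (irrA a a′) (irrB b b′)

prefixOK-suc : ∀ h w → T (prefixOK h w) → T (prefixOK (suc h) w)
prefixOK-suc h       []      ok = ok
prefixOK-suc h       (u ∷ w) ok = prefixOK-suc (suc h) w ok
prefixOK-suc (suc h) (d ∷ w) ok = prefixOK-suc h w ok

match-total : ∀ o a w → T (prefixOK o w) →
              proj₁ (match o a w) + proj₂ (match o a w) ≡ o + a + #u w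
match-total o       a []      _  = sym (+-identityʳ (o + a))
match-total o       a (u ∷ w) ok =
  trans (match-total (suc o) a w ok) (sym (+-suc (o + a) (#u w)))
match-total (suc o) a (d ∷ w) ok =
  trans (match-total o (suc a) w ok) (cong (_+ #u w) (+-suc o a))

arches+halfArches≡#u : ∀ w → IsSymDyck w → arches w + halfArches w ≡ #u w
arches+halfArches≡#u w ok =
  trans (+-comm (arches w) (halfArches w)) (match-total 0 0 w ok)

Descent : ℕ → Word → Set
Descent h v = T (prefixOK (suc h) v) × #d v ≡ suc h + #u v

-- collapse h v reads v from height suc h.  At each return to height 0 the d is
-- dropped, so the u starting the next excursion becomes unmatched.
collapse : ℕ → Word → Word
collapse h       []          = []
collapse h       (u ∷ v)     = u ∷ collapse (suc h) v
collapse (suc h) (d ∷ v)     = d ∷ collapse h v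
collapse zero    (d ∷ u ∷ v) = u ∷ collapse zero v
collapse zero    (d ∷ _)     = []

collapse-prefixOK : ∀ h v → T (prefixOK (suc h) v) → T (prefixOK h (collapse h v))
collapse-prefixOK h       []          ok = ok
collapse-prefixOK h       (u ∷ v)     ok = collapse-prefixOK (suc h) v ok
collapse-prefixOK (suc h) (d ∷ v)     ok = collapse-prefixOK h v ok
collapse-prefixOK zero    (d ∷ [])    ok = ok
collapse-prefixOK zero    (d ∷ u ∷ v) ok = prefixOK-suc 0 (collapse 0 v) (collapse-prefixOK 0 v ok)

collapse-#u : ∀ h v → T (prefixOK (suc h) v) → #u (collapse h v) ≡ #u v
collapse-#u h       []          _  = refl
collapse-#u h       (u ∷ v)     ok = cong suc (collapse-#u (suc h) v ok)
collapse-#u (suc h) (d ∷ v)     ok = collapse-#u h v ok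
collapse-#u zero    (d ∷ [])    _  = refl
collapse-#u zero    (d ∷ u ∷ v) ok = cong suc (collapse-#u 0 v ok)

-- The inverse of collapse, computed from the right while counting the d's not
-- yet matched: a u meeting an empty count is unmatched and becomes d u.
prependD : Word × ℕ → Word × ℕ
prependD (x , c) = d ∷ x , suc c

prependU : Word × ℕ → Word × ℕ
prependU (x , zero)  = d ∷ u ∷ x , zero
prependU (x , suc c) = u ∷ x , c

expand : Word → Word × ℕ
expand []      = d ∷ [] , 0
expand (d ∷ w) = prependD (expand w)
expand (u ∷ w) = prependU (expand w)

expand-descent : ∀ w → Descent (proj₂ (expand w)) (proj₁ (expand w))
expand-descent []      = _ , refl
expand-descent (d ∷ w) with expand w | expand-descent w
... | x , c     | ok , e = ok , cong suc e
expand-descent (u ∷ w) with expand w | expand-descent w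
... | x , zero  | ok , e = ok , cong suc e
... | x , suc c | ok , e = ok , trans e (cong suc (sym (+-suc c (#u x))))

expand-#u : ∀ w → #u (proj₁ (expand w)) ≡ #u w
expand-#u []      = refl
expand-#u (d ∷ w) with expand w | expand-#u w
... | x , c     | e = e
expand-#u (u ∷ w) with expand w | expand-#u w
... | x , zero  | e = cong suc e
... | x , suc c | e = cong suc e

expand-unmatched≤ : ∀ h w → T (prefixOK h w) → proj₂ (expand w) ≤ h
expand-unmatched≤ h       []      _  = z≤n
expand-unmatched≤ (suc h) (d ∷ w) ok with expand w | expand-unmatched≤ h w ok
... | x , c     | c≤h       = s≤s c≤h
expand-unmatched≤ h       (u ∷ w) ok with expand w | expand-unmatched≤ (suc h) w ok
... | x , zero  | _         = z≤n
... | x , suc c | s≤s c≤h   = c≤h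

expand-unmatched≡0 : ∀ w → IsSymDyck w → proj₂ (expand w) ≡ 0
expand-unmatched≡0 w ok = n≤0⇒n≡0 (expand-unmatched≤ 0 w ok)

collapse-expand : ∀ w → collapse (proj₂ (expand w)) (proj₁ (expand w)) ≡ w
collapse-expand []      = refl
collapse-expand (d ∷ w) with expand w | collapse-expand w
... | x , c     | e = cong (d ∷_) e
collapse-expand (u ∷ w) with expand w | collapse-expand w
... | x , zero  | e = cong (u ∷_) e
... | x , suc c | e = cong (u ∷_) e

expand-collapse : ∀ h v → Descent h v → expand (collapse h v) ≡ (v , h)
expand-collapse h       (u ∷ v)     (ok , e)
  rewrite expand-collapse (suc h) v (ok , trans e (+-suc (suc h) (#u v))) = refl
expand-collapse (suc h) (d ∷ v)     (ok , e)
  rewrite expand-collapse h v (ok , suc-injective e) = refl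
expand-collapse zero    (d ∷ [])    _        = refl
expand-collapse zero    (d ∷ u ∷ v) (ok , e)
  rewrite expand-collapse zero v (ok , suc-injective e) = refl

collapse-sym : ∀ w → IsSymDyck w → collapse 0 (proj₁ (expand w)) ≡ w
collapse-sym w ok =
  subst (λ c → collapse c (proj₁ (expand w)) ≡ w) (expand-unmatched≡0 w ok) (collapse-expand w)

SymDyckAH-irrelevant : ∀ n w → Irrelevant (IsSymDyck w × arches w + halfArches w ≡ n)
SymDyckAH-irrelevant n w = ×-irrelevant T-irrelevant ≡-irrelevant

IsDyck-irrelevant : ∀ m w → Irrelevant (IsDyck m w)
IsDyck-irrelevant m w = ×-irrelevant (×-irrelevant ≡-irrelevant ≡-irrelevant) T-irrelevant

fromDyck : ∀ n → DyckPaths (suc n) → SymDyckAH n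
fromDyck n ([]    , (() , _) , _)
fromDyck n (u ∷ v , (#u≡ , _) , ok) = collapse 0 v , w-ok , ah≡n
  where
  w-ok : IsSymDyck (collapse 0 v)
  w-ok = collapse-prefixOK 0 v ok
  ah≡n : arches (collapse 0 v) + halfArches (collapse 0 v) ≡ n
  ah≡n = trans (arches+halfArches≡#u (collapse 0 v) w-ok)
               (trans (collapse-#u 0 v ok) (suc-injective #u≡))

toDyck : ∀ n → SymDyckAH n → DyckPaths (suc n)
toDyck n (w , ok , ah≡n) =
  u ∷ x , (cong suc #x≡n , trans (proj₂ descent) (cong suc #x≡n)) , proj₁ descent
  where
  x : Word
  x = proj₁ (expand w)
  #x≡n : #u x ≡ n
  #x≡n = trans (expand-#u w) (trans (sym (arches+halfArches≡#u w ok)) ah≡n)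
  descent : Descent 0 x
  descent = subst (λ c → Descent c x) (expand-unmatched≡0 w ok) (expand-descent w)

fromDyck-toDyck : ∀ n s → fromDyck n (toDyck n s) ≡ s
fromDyck-toDyck n (w , ok , _) =
  Σ-≡-irrelevant (SymDyckAH-irrelevant n) (collapse-sym w ok)

toDyck-fromDyck : ∀ n p → toDyck n (fromDyck n p) ≡ p
toDyck-fromDyck n ([]    , (() , _) , _)
toDyck-fromDyck n (u ∷ v , (#u≡ , #d≡) , ok) =
  Σ-≡-irrelevant (IsDyck-irrelevant (suc n))
    (cong (u ∷_) (cong proj₁ (expand-collapse 0 v (ok , trans #d≡ (sym #u≡)))))

corollary7p8 : (n : ℕ) → DyckPaths (suc n) ⤖ SymDyckAH n
corollary7p8 n = ↔⇒⤖ (mk↔ₛ′ (fromDyck n) (toDyck n) (fromDyck-toDyck n) (toDyck-fromDyck n))
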